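{- Let $k \geq 3$ be an integer and let $G_0=(V,E)$ be a graph on $n\geq 6$ vertices. Suppose $G_0$ has a non-trivial connected component $C_1$ such that $G_0[C_1]$ has a Hamilton cycle, and $d_{G_0}(u)=0$ for every $u\in V\setminus C_1$. Assume Mini is the second player. (a) If $|C_1|=2k-1$, then $s(G_0,\mathcal{M}_k)\leq\binom{2k-1}{2}$. (b) If $|C_1|=2k-2$ and $\binom{2k-2}{2}-e(G_0)$ is even, then $s(G_0,\mathcal{M}_k)\leq\binom{2k-1}{2}$.
   Context: A connected component is non-trivial if it contains an edge. $\mathcal{M}_k$ is the property of admitting a matching of size $k$. For a graph $H$ with no matching of size $k$, the saturation game $(H,\mathcal{M}_k)$ is played as follows. Starting with $G=H$, two players, Mini and Max, alternately add to $G$ an edge $e\notin E(G)$ such that $G\cup\{e\}$ has no matching of size $k$. The game ends when no such edge exists. Max wants to maximize and Mini to minimize the final number of edges. The score $s(H,\mathcal{M}_k)$ is the number of edges of the final graph under optimal play. $e(G_0)$ is the number of edges of $G_0$. -}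

module Defs where

open import Data.Nat using (ℕ; zero; suc; _+_; _∸_; _≤_; _<ᵇ_)
open import Data.Bool using (Bool; true; false; _∧_; _∨_; if_then_else_)
open import Data.Fin using (Fin; toℕ; _≟_)
open import Data.List using (List; map; allFin)
open import Data.Nat.ListAction using (sum)
open import Data.Product using (Σ; _×_; _,_; ∃)
open import Relation.Nullary using (¬_; yes; no)
open import Relation.Nullary.Decidable using (⌊_⌋)
open import Relation.Binary.PropositionalEquality using (_≡_; _≢_; refl)

record Graph (n : ℕ) : Set where
  field
    adj    : Fin n → Fin n → Bool
    sym    : ∀ u v → adj u v ≡ adj v u
    irrefl : ∀ u → adj u u ≡ false
open Graph public

edges : ∀ {n} → Graph n → ℕ
edges {n} G =
  sum (map (λ i → sum (map (λ j → if (toℕ i <ᵇ toℕ j) ∧ adj G i j then 1 else 0)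
                           (allFin n)))
           (allFin n))

degree : ∀ {n} → Graph n → Fin n → ℕ
degree {n} G u = sum (map (λ v → if adj G u v then 1 else 0) (allFin n))

HasMatching : ∀ {n} → Graph n → ℕ → Set
HasMatching {n} G k =
  Σ (Fin k → Fin n) λ a → Σ (Fin k → Fin n) λ b →
    (∀ i → adj G (a i) (b i) ≡ true) ×
    (∀ i j → a i ≡ a j → i ≡ j) ×
    (∀ i j → b i ≡ b j → i ≡ j) ×
    (∀ i j → a i ≢ b j)

private
  isPair : ∀ {n} → Fin n → Fin n → Fin n → Fin n → Bool
  isPair u v x y = (⌊ x ≟ u ⌋ ∧ ⌊ y ≟ v ⌋) ∨ (⌊ x ≟ v ⌋ ∧ ⌊ y ≟ u ⌋)

  ∧-comm : ∀ a b → a ∧ b ≡ b ∧ a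
  ∧-comm false false = refl
  ∧-comm false true = refl
  ∧-comm true false = refl
  ∧-comm true true = refl

  ∨-comm : ∀ a b → a ∨ b ≡ b ∨ a
  ∨-comm false false = refl
  ∨-comm false true = refl
  ∨-comm true false = refl
  ∨-comm true true = refl

  isPair-sym : ∀ {n} (u v x y : Fin n) → isPair u v x y ≡ isPair u v y x
  isPair-sym u v x y
    rewrite ∧-comm ⌊ x ≟ u ⌋ ⌊ y ≟ v ⌋ | ∧-comm ⌊ x ≟ v ⌋ ⌊ y ≟ u ⌋
    = ∨-comm (⌊ y ≟ v ⌋ ∧ ⌊ x ≟ u ⌋) (⌊ y ≟ u ⌋ ∧ ⌊ x ≟ v ⌋)

  isPair-diag : ∀ {n} (u v x : Fin n) → u ≢ v → isPair u v x x ≡ false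
  isPair-diag u v x u≢v with x ≟ u | x ≟ v
  ... | yes refl | yes refl = Data.Empty.⊥-elim (u≢v refl)
    where import Data.Empty
  ... | yes _ | no _ = refl
  ... | no _ | yes _ = refl
  ... | no _ | no _ = refl

  cong₂∨ : ∀ {a b c d} → a ≡ b → c ≡ d → a ∨ c ≡ b ∨ d
  cong₂∨ refl refl = refl

addEdge : ∀ {n} (G : Graph n) (u v : Fin n) → u ≢ v → Graph n
addEdge G u v u≢v = record
  { adj    = λ x y → adj G x y ∨ isPair u v x y
  ; sym    = λ x y → cong₂∨ (sym G x y) (isPair-sym u v x y)
  ; irrefl = λ x → cong₂∨ (irrefl G x) (isPair-diag u v x u≢v)
  }

record Legal {n} (k : ℕ) (G : Graph n) (u v : Fin n) : Set where
  field
    distinct : u ≢ v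
    nonEdge  : adj G u v ≡ false
    noMatch  : ¬ HasMatching (addEdge G u v distinct) k
open Legal public

play : ∀ {n k} (G : Graph n) {u v : Fin n} → Legal k G u v → Graph n
play G {u} {v} l = addEdge G u v (distinct l)

data Player : Set where
  Max Mini : Player

-- MiniForces k B p G : in the game (G, M_k) with player p to move,
-- Mini has a strategy guaranteeing that the final graph has at most B
-- edges, whatever Max does.  (The game is finite, so this is exactly
-- "the score under optimal play is at most B".)
data MiniForces {n} (k B : ℕ) : Player → Graph n → Set where
  finished : ∀ {p G} → (∀ u v → ¬ Legal k G u v) → edges G ≤ B →
             MiniForces k B p G
  maxMove  : ∀ {G} → (∃ λ u → ∃ λ v → Legal k G u v) →
             (∀ u v (l : Legal k G u v) → MiniForces k B Mini (play G l)) →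
             MiniForces k B Max G
  miniMove : ∀ {G} u v (l : Legal k G u v) → MiniForces k B Max (play G l) →
             MiniForces k B Mini G

-- s(H, M_k) ≤ B when Max moves first (Mini is the second player).
ScoreMiniSecond≤ : ∀ {n} → Graph n → ℕ → ℕ → Set
ScoreMiniSecond≤ H k B = MiniForces k B Max H

-- G has a Hamilton cycle on a vertex set C of size m (m ≥ 3), given
-- by an injective enumeration c : Fin m → Fin n of C with c i ~ c (i+1 mod m).
IsCycleEnum : ∀ {n m} → Graph n → (Fin m → Fin n) → Set
IsCycleEnum {n} {m} G c =
  (∀ i j → c i ≡ c j → i ≡ j) ×
  (∀ i j → (toℕ j ≡ suc (toℕ i)) → adj G (c i) (c j) ≡ true) ×
  (∀ i j → toℕ i ≡ m ∸ 1 → toℕ j ≡ 0 → adj G (c i) (c j) ≡ true)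

HamComponentRestIsolated : ∀ {n} → Graph n → (m : ℕ) → Set
HamComponentRestIsolated {n} G m =
  Σ (Fin m → Fin n) λ c →
    IsCycleEnum G c ×
    (∀ u → (∀ i → c i ≢ u) → degree G u ≡ 0)

-- Let C₁ be the Hamilton component, m = |C₁|, and k the matching size.  An edge joining
-- two vertices outside C₁ is never legal: with k − 1 edges of the cycle it is a k-matching.
-- If m = 2k − 1, a pendant edge x c_l is not legal either: the other 2k − 2 cycle vertices
-- are paired along the cycle.  So play stays inside C₁, which spans at most C(2k−1, 2) edges.
-- If m = 2k − 2, every edge meeting C₁ is legal (it lives on at most 2k − 1 vertices).  Mini
-- answers a move inside C₁ by another one, which the parity hypothesis always allows; a
-- pendant move w cᵢ she answers by w cᵢ₊₁.  Afterwards an edge x c_l with x ∉ C₁ ∪ {w} is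
-- illegal: one of cᵢ, cᵢ₊₁ lies at odd distance from c_l on the cycle, so the cycle splits
-- into two even arcs around the edges x c_l and w cᵢ(₊₁).  Hence play stays inside the
-- 2k − 1 vertices C₁ ∪ {w}.

module Submission where

open import Defs hiding (sym)
open import Data.Bool using (Bool; true; false; _∧_; _∨_; not; if_then_else_; T)
import Data.Bool.Properties as Bool
open import Data.Empty using (⊥; ⊥-elim)
open import Data.Unit using (tt)
open import Data.Fin using (Fin; zero; suc; toℕ; fromℕ<; _≟_; splitAt; _↑ˡ_; _↑ʳ_)
  renaming (_<_ to _<ᶠ_)
open import Data.Fin.Properties
  using (toℕ-injective; toℕ<n; toℕ-fromℕ<; pigeonhole; splitAt⁻¹-↑ˡ; splitAt⁻¹-↑ʳ; any?)
  renaming (suc-injective to suc-injectiveᶠ)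
open import Data.List using (map; allFin; tabulate)
open import Data.List.Properties using (map-tabulate)
open import Data.Nat
  using (ℕ; zero; suc; _+_; _*_; _∸_; _≤_; _<_; _<ᵇ_; z≤n; s≤s; _<?_; _≤?_; NonZero; >-nonZero)
open import Data.Nat.DivMod
  using (_%_; %-distribˡ-+; m<n⇒m%n≡m; m%n<n; m≤n⇒[n∸m]%m≡n%m; [m+n]%n≡m%n; n%n≡0)
open import Data.Nat.Divisibility using (_∣_; divides)
open import Data.Nat.Combinatorics using (_C_; nC1≡n; nCk+nC[k+1]≡[n+1]C[k+1])
import Data.Nat.ListAction as List
open import Data.Nat.Properties hiding (_≟_)
open import Algebra.Properties.CommutativeMonoid.Sum +-0-commutativeMonoid
  using (sum-syntax; sum-cong-≗; ∑-distrib-+; sum-replicate-zero)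
open import Data.Product using (∃; _×_; _,_; proj₁; proj₂)
open import Data.Sum using (_⊎_; inj₁; inj₂; [_,_]′)
open import Data.Vec.Functional using (_∷_)
open import Function using (_∘_; id)
open import Function.Definitions using (Injective)
open import Relation.Nullary using (¬_; yes; no; Dec)
open import Relation.Nullary.Decidable using (⌊_⌋; _×-dec_; _⊎-dec_; ¬?)
open import Relation.Binary.PropositionalEquality hiding (J)
open import Relation.Binary.Definitions using (tri<; tri≈; tri>)

open Graph using () renaming (sym to adj-sym)

-- Counting pairs

false≢true : false ≢ true
false≢true ()

𝟙 : Bool → ℕ
𝟙 b = if b then 1 else 0

sum-tabulate : ∀ {n} (f : Fin n → ℕ) → List.sum (tabulate f) ≡ ∑[ i < n ] f i
sum-tabulate {zero}  f = refl
sum-tabulate {suc n} f = cong (f zero +_) (sum-tabulate (f ∘ suc))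

sum-map-allFin : ∀ {n} (f : Fin n → ℕ) → List.sum (map f (allFin n)) ≡ ∑[ i < n ] f i
sum-map-allFin f = trans (cong List.sum (map-tabulate id f)) (sum-tabulate f)

∑-zero : ∀ {n} {f : Fin n → ℕ} → (∀ i → f i ≡ 0) → ∑[ i < n ] f i ≡ 0
∑-zero {n} f≗0 = trans (sum-cong-≗ f≗0) (sum-replicate-zero n)

∑≡0⇒≡0 : ∀ {n} (f : Fin n → ℕ) → ∑[ i < n ] f i ≡ 0 → ∀ i → f i ≡ 0
∑≡0⇒≡0 f ∑≡0 zero    = m+n≡0⇒m≡0 (f zero) ∑≡0
∑≡0⇒≡0 f ∑≡0 (suc i) = ∑≡0⇒≡0 (f ∘ suc) (m+n≡0⇒n≡0 (f zero) ∑≡0) i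

∑-indicator : ∀ {n} (b : Fin n) c → ∑[ i < n ] (if ⌊ i ≟ b ⌋ then c else 0) ≡ c
∑-indicator {suc n} zero c = trans (cong (c +_) (∑-zero {n} (λ _ → refl))) (+-identityʳ c)
∑-indicator {suc n} (suc b) c = trans (sum-cong-≗ shift) (∑-indicator b c)
  where
  shift : ∀ i → (if ⌊ suc i ≟ suc b ⌋ then c else 0) ≡ (if ⌊ i ≟ b ⌋ then c else 0)
  shift i with i ≟ b
  ... | yes refl = refl
  ... | no _     = refl

∑∑-indicator : ∀ {n} (a b : Fin n) c →
  ∑[ i < n ] ∑[ j < n ] (if ⌊ i ≟ a ⌋ then (if ⌊ j ≟ b ⌋ then c else 0) else 0) ≡ c
∑∑-indicator {n} a b c = trans (sum-cong-≗ row) (∑-indicator a c)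
  where
  row : ∀ i → ∑[ j < n ] (if ⌊ i ≟ a ⌋ then (if ⌊ j ≟ b ⌋ then c else 0) else 0)
            ≡ (if ⌊ i ≟ a ⌋ then c else 0)
  row i with ⌊ i ≟ a ⌋
  ... | true  = ∑-indicator b c
  ... | false = ∑-zero {n} (λ _ → refl)

count : ∀ {n} → (Fin n → Bool) → ℕ
count {n} s = ∑[ v < n ] 𝟙 (s v)

choose2 : ℕ → ℕ
choose2 zero    = 0
choose2 (suc a) = a + choose2 a

choose2≡C2 : ∀ a → choose2 a ≡ a C 2
choose2≡C2 zero    = refl
choose2≡C2 (suc a) =
  trans (cong₂ _+_ (sym (nC1≡n a)) (choose2≡C2 a)) (nCk+nC[k+1]≡[n+1]C[k+1] a 1)

pairCount : ∀ {n} → (Fin n → Fin n → Bool) → ℕ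
pairCount {n} Q = ∑[ i < n ] ∑[ j < n ] 𝟙 ((toℕ i <ᵇ toℕ j) ∧ Q i j)

edges≡pairCount : ∀ {n} (G : Graph n) → edges G ≡ pairCount (adj G)
edges≡pairCount {n} G =
  trans (sum-map-allFin (λ i → List.sum (map (entry i) (allFin n))))
        (sum-cong-≗ (λ i → sum-map-allFin (entry i)))
  where
  entry : Fin n → Fin n → ℕ
  entry i j = 𝟙 ((toℕ i <ᵇ toℕ j) ∧ adj G i j)

pairCount-cong : ∀ {n} {Q R : Fin n → Fin n → Bool} →
  (∀ i j → Q i j ≡ R i j) → pairCount Q ≡ pairCount R
pairCount-cong Q≗R = sum-cong-≗ (λ i → sum-cong-≗ (λ j → cong (𝟙 ∘ (_ ∧_)) (Q≗R i j)))

𝟙-∧-disjoint-∨ : ∀ a b c → b ∧ c ≡ false → 𝟙 (a ∧ (b ∨ c)) ≡ 𝟙 (a ∧ b) + 𝟙 (a ∧ c)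
𝟙-∧-disjoint-∨ false b     c     _  = refl
𝟙-∧-disjoint-∨ true  false c     _  = refl
𝟙-∧-disjoint-∨ true  true  false _  = refl
𝟙-∧-disjoint-∨ true  true  true  ()

pairCount-disjoint-∨ : ∀ {n} (Q R : Fin n → Fin n → Bool) → (∀ i j → Q i j ∧ R i j ≡ false) →
  pairCount (λ i j → Q i j ∨ R i j) ≡ pairCount Q + pairCount R
pairCount-disjoint-∨ {n} Q R disjoint = begin
  pairCount (λ i j → Q i j ∨ R i j)
    ≡⟨ sum-cong-≗ (λ i → sum-cong-≗ (λ j → 𝟙-∧-disjoint-∨ _ (Q i j) (R i j) (disjoint i j))) ⟩
  ∑[ i < n ] ∑[ j < n ] (𝟙 (lt i j ∧ Q i j) + 𝟙 (lt i j ∧ R i j))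
    ≡⟨ sum-cong-≗ (λ i → ∑-distrib-+ (λ j → 𝟙 (lt i j ∧ Q i j)) (λ j → 𝟙 (lt i j ∧ R i j))) ⟩
  ∑[ i < n ] (∑[ j < n ] 𝟙 (lt i j ∧ Q i j) + ∑[ j < n ] 𝟙 (lt i j ∧ R i j))
    ≡⟨ ∑-distrib-+ (λ i → ∑[ j < n ] 𝟙 (lt i j ∧ Q i j)) (λ i → ∑[ j < n ] 𝟙 (lt i j ∧ R i j)) ⟩
  pairCount Q + pairCount R ∎
  where
  open ≡-Reasoning
  lt : Fin n → Fin n → Bool
  lt i j = toℕ i <ᵇ toℕ j

pairCount-square : ∀ {n} (s : Fin n → Bool) → pairCount (λ i j → s i ∧ s j) ≡ choose2 (count s)
pairCount-square {zero}  s = refl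
pairCount-square {suc n} s with s zero
... | true  = cong (count (s ∘ suc) +_) (pairCount-square (s ∘ suc))
... | false = trans (cong (_+ pairCount (λ i j → s (suc i) ∧ s (suc j))) (∑-zero {n} (λ _ → refl)))
                    (pairCount-square (s ∘ suc))

-- Adding edges

emptyGraph : ∀ {n} → Graph n
emptyGraph = record { adj = λ _ _ → false ; sym = λ _ _ → refl ; irrefl = λ _ → refl }

edgeGraph : ∀ {n} (u v : Fin n) → u ≢ v → Graph n
edgeGraph = addEdge emptyGraph

edgeGraph-adj : ∀ {n} (u v : Fin n) (u≢v : u ≢ v) x y →
  adj (edgeGraph u v u≢v) x y ≡ (⌊ x ≟ u ⌋ ∧ ⌊ y ≟ v ⌋) ∨ (⌊ x ≟ v ⌋ ∧ ⌊ y ≟ u ⌋)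
edgeGraph-adj u v u≢v x y = refl

edgeGraph-adj⁻ : ∀ {n} (u v : Fin n) (u≢v : u ≢ v) x y → adj (edgeGraph u v u≢v) x y ≡ true →
  (x ≡ u × y ≡ v) ⊎ (x ≡ v × y ≡ u)
edgeGraph-adj⁻ u v u≢v x y e with x ≟ u | y ≟ v | x ≟ v | y ≟ u
... | yes p | yes q | _     | _     = inj₁ (p , q)
... | _     | _     | yes p | yes q = inj₂ (p , q)
... | no _  | _     | no _  | _     = ⊥-elim (false≢true e)
... | no _  | _     | yes _ | no _  = ⊥-elim (false≢true e)
... | yes _ | no _  | no _  | _     = ⊥-elim (false≢true e)
... | yes _ | no _  | yes _ | no _  = ⊥-elim (false≢true e)

pairCount-single : ∀ {n} (a b : Fin n) →
  pairCount (λ i j → ⌊ i ≟ a ⌋ ∧ ⌊ j ≟ b ⌋) ≡ 𝟙 (toℕ a <ᵇ toℕ b)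
pairCount-single {n} a b =
  trans (sum-cong-≗ (λ i → sum-cong-≗ (entry i))) (∑∑-indicator a b (𝟙 (toℕ a <ᵇ toℕ b)))
  where
  entry : ∀ i j → 𝟙 ((toℕ i <ᵇ toℕ j) ∧ (⌊ i ≟ a ⌋ ∧ ⌊ j ≟ b ⌋))
                ≡ (if ⌊ i ≟ a ⌋ then (if ⌊ j ≟ b ⌋ then 𝟙 (toℕ a <ᵇ toℕ b) else 0) else 0)
  entry i j with i ≟ a | j ≟ b
  ... | yes refl | yes refl = cong 𝟙 (Bool.∧-identityʳ _)
  ... | yes refl | no _     = cong 𝟙 (Bool.∧-zeroʳ _)
  ... | no _     | _        = cong 𝟙 (Bool.∧-zeroʳ _)

n<ᵇn≡false : ∀ n → (n <ᵇ n) ≡ false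
n<ᵇn≡false zero    = refl
n<ᵇn≡false (suc n) = n<ᵇn≡false n

𝟙<ᵇ+𝟙>ᵇ : ∀ {n} {a b : Fin n} → a ≢ b → 𝟙 (toℕ a <ᵇ toℕ b) + 𝟙 (toℕ b <ᵇ toℕ a) ≡ 1
𝟙<ᵇ+𝟙>ᵇ {a = a} {b} a≢b with toℕ a <ᵇ toℕ b in ab | toℕ b <ᵇ toℕ a in ba
... | true  | false = refl
... | false | true  = refl
... | true  | true  = ⊥-elim (<-asym (<ᵇ⇒< (toℕ a) (toℕ b) (subst T (sym ab) tt))
                                    (<ᵇ⇒< (toℕ b) (toℕ a) (subst T (sym ba) tt)))
... | false | false = ⊥-elim (a≢b (toℕ-injective (≤-antisym (≮⇒≥ (subst T ba ∘ <⇒<ᵇ))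
                                                           (≮⇒≥ (subst T ab ∘ <⇒<ᵇ)))))

pairCount-edgeGraph : ∀ {n} (u v : Fin n) (u≢v : u ≢ v) → pairCount (adj (edgeGraph u v u≢v)) ≡ 1
pairCount-edgeGraph u v u≢v = begin
  pairCount (adj (edgeGraph u v u≢v))
    ≡⟨ pairCount-cong (edgeGraph-adj u v u≢v) ⟩
  pairCount (λ i j → (⌊ i ≟ u ⌋ ∧ ⌊ j ≟ v ⌋) ∨ (⌊ i ≟ v ⌋ ∧ ⌊ j ≟ u ⌋))
    ≡⟨ pairCount-disjoint-∨ (λ i j → ⌊ i ≟ u ⌋ ∧ ⌊ j ≟ v ⌋) (λ i j → ⌊ i ≟ v ⌋ ∧ ⌊ j ≟ u ⌋)
                            disjoint ⟩
  pairCount (λ i j → ⌊ i ≟ u ⌋ ∧ ⌊ j ≟ v ⌋) + pairCount (λ i j → ⌊ i ≟ v ⌋ ∧ ⌊ j ≟ u ⌋)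
    ≡⟨ cong₂ _+_ (pairCount-single u v) (pairCount-single v u) ⟩
  𝟙 (toℕ u <ᵇ toℕ v) + 𝟙 (toℕ v <ᵇ toℕ u)
    ≡⟨ 𝟙<ᵇ+𝟙>ᵇ u≢v ⟩
  1 ∎
  where
  open ≡-Reasoning
  disjoint : ∀ i j → (⌊ i ≟ u ⌋ ∧ ⌊ j ≟ v ⌋) ∧ (⌊ i ≟ v ⌋ ∧ ⌊ j ≟ u ⌋) ≡ false
  disjoint i j with i ≟ u | i ≟ v
  ... | yes refl | yes refl = ⊥-elim (u≢v refl)
  ... | yes _    | no _     = Bool.∧-zeroʳ _
  ... | no _     | _        = refl

record _⊆_ {n} (G H : Graph n) : Set where
  field
    ⊆-adj : ∀ x y → adj G x y ≡ true → adj H x y ≡ true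
open _⊆_

⊆-refl : ∀ {n} {G : Graph n} → G ⊆ G
⊆-adj ⊆-refl _ _ e = e

⊆-addEdge : ∀ {n} (G : Graph n) u v u≢v → G ⊆ addEdge G u v u≢v
⊆-adj (⊆-addEdge G u v u≢v) x y e rewrite e = refl

⊆-addEdgeʳ : ∀ {n} {G : Graph n} H u v u≢v → G ⊆ H → G ⊆ addEdge H u v u≢v
⊆-adj (⊆-addEdgeʳ H u v u≢v G⊆H) x y e = ⊆-adj (⊆-addEdge H u v u≢v) x y (⊆-adj G⊆H x y e)

addEdge-joins : ∀ {n} (G : Graph n) u v u≢v → adj (addEdge G u v u≢v) u v ≡ true
addEdge-joins G u v u≢v with adj G u v | u ≟ u | v ≟ v
... | true  | _      | _      = refl
... | false | yes _  | yes _  = refl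
... | false | no u≢u | _      = ⊥-elim (u≢u refl)
... | false | yes _  | no v≢v = ⊥-elim (v≢v refl)

addEdge-joins′ : ∀ {n} (G : Graph n) u v u≢v → adj (addEdge G u v u≢v) v u ≡ true
addEdge-joins′ G u v u≢v = trans (adj-sym (addEdge G u v u≢v) v u) (addEdge-joins G u v u≢v)

addEdge-adj⁻ : ∀ {n} (G : Graph n) u v u≢v x y → adj (addEdge G u v u≢v) x y ≡ true →
  adj G x y ≡ true ⊎ (x ≡ u × y ≡ v) ⊎ (x ≡ v × y ≡ u)
addEdge-adj⁻ G u v u≢v x y e with adj G x y
... | true  = inj₁ refl
... | false = inj₂ (edgeGraph-adj⁻ u v u≢v x y e)

addEdge-mono : ∀ {n} {G H : Graph n} u v u≢v → G ⊆ H → addEdge G u v u≢v ⊆ addEdge H u v u≢v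
⊆-adj (addEdge-mono {G = G} {H} u v u≢v G⊆H) x y e with addEdge-adj⁻ G u v u≢v x y e
... | inj₁ e′                  = ⊆-adj (⊆-addEdgeʳ H u v u≢v G⊆H) x y e′
... | inj₂ (inj₁ (refl , refl)) = addEdge-joins H u v u≢v
... | inj₂ (inj₂ (refl , refl)) = addEdge-joins′ H u v u≢v

edges-addEdge : ∀ {n} (G : Graph n) u v u≢v → adj G u v ≡ false →
  edges (addEdge G u v u≢v) ≡ suc (edges G)
edges-addEdge G u v u≢v uv∉G = begin
  edges (addEdge G u v u≢v)
    ≡⟨ edges≡pairCount (addEdge G u v u≢v) ⟩
  pairCount (λ i j → adj G i j ∨ adj (edgeGraph u v u≢v) i j)
    ≡⟨ pairCount-disjoint-∨ (adj G) (adj (edgeGraph u v u≢v)) disjoint ⟩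
  pairCount (adj G) + pairCount (adj (edgeGraph u v u≢v))
    ≡⟨ cong₂ _+_ (sym (edges≡pairCount G)) (pairCount-edgeGraph u v u≢v) ⟩
  edges G + 1
    ≡⟨ +-comm (edges G) 1 ⟩
  suc (edges G) ∎
  where
  open ≡-Reasoning
  disjoint : ∀ i j → adj G i j ∧ adj (edgeGraph u v u≢v) i j ≡ false
  disjoint i j with adj (edgeGraph u v u≢v) i j in e
  ... | false = Bool.∧-zeroʳ _
  ... | true with edgeGraph-adj⁻ u v u≢v i j e
  ...   | inj₁ (refl , refl) = cong (_∧ true) uv∉G
  ...   | inj₂ (refl , refl) = cong (_∧ true) (trans (adj-sym G i j) uv∉G)

addEdge-pendant : ∀ {n} (G : Graph n) u v u≢v {w a} → (∀ y → adj G w y ≡ false) →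
  (u ≡ w × v ≡ a) ⊎ (u ≡ a × v ≡ w) →
  adj (addEdge G u v u≢v) w a ≡ true × (∀ y → adj (addEdge G u v u≢v) w y ≡ true → y ≡ a)
addEdge-pendant G u v u≢v u-isolated (inj₁ (refl , refl)) = addEdge-joins G u v u≢v , only
  where
  only : ∀ y → adj (addEdge G u v u≢v) u y ≡ true → y ≡ v
  only y uy∈ with addEdge-adj⁻ G u v u≢v u y uy∈
  ... | inj₁ uy∈G             = ⊥-elim (false≢true (trans (sym (u-isolated y)) uy∈G))
  ... | inj₂ (inj₁ (_ , y≡v)) = y≡v
  ... | inj₂ (inj₂ (u≡v , _)) = ⊥-elim (u≢v u≡v)
addEdge-pendant G u v u≢v v-isolated (inj₂ (refl , refl)) = addEdge-joins′ G u v u≢v , only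
  where
  only : ∀ y → adj (addEdge G u v u≢v) v y ≡ true → y ≡ u
  only y vy∈ with addEdge-adj⁻ G u v u≢v v y vy∈
  ... | inj₁ vy∈G             = ⊥-elim (false≢true (trans (sym (v-isolated y)) vy∈G))
  ... | inj₂ (inj₁ (v≡u , _)) = ⊥-elim (u≢v (sym v≡u))
  ... | inj₂ (inj₂ (_ , y≡u)) = y≡u

ends-in : ∀ {A : Set} {s : A → Bool} {u v w a} → (u ≡ w × v ≡ a) ⊎ (u ≡ a × v ≡ w) →
  s w ≡ true → s a ≡ true → s u ≡ true × s v ≡ true
ends-in (inj₁ (refl , refl)) sw sa = sw , sa
ends-in (inj₂ (refl , refl)) sw sa = sa , sw

-- By symmetry of adj, this puts both endpoints of every edge of G in s.
EdgesWithin : ∀ {n} → Graph n → (Fin n → Bool) → Set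
EdgesWithin G s = ∀ x y → adj G x y ≡ true → s x ≡ true

EdgesWithin-addEdge : ∀ {n} (G : Graph n) s u v u≢v → EdgesWithin G s →
  s u ≡ true → s v ≡ true → EdgesWithin (addEdge G u v u≢v) s
EdgesWithin-addEdge G s u v u≢v within su sv x y e with addEdge-adj⁻ G u v u≢v x y e
... | inj₁ e′              = within x y e′
... | inj₂ (inj₁ (refl , _)) = su
... | inj₂ (inj₂ (refl , _)) = sv

EdgesWithin-mono : ∀ {n} {G : Graph n} {s t : Fin n → Bool} → (∀ x → s x ≡ true → t x ≡ true) →
  EdgesWithin G s → EdgesWithin G t
EdgesWithin-mono s⊆t within x y xy∈G = s⊆t x (within x y xy∈G)

missing : ∀ {n} → (Fin n → Bool) → Graph n → ℕ
missing s G = pairCount (λ i j → (s i ∧ s j) ∧ not (adj G i j))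

edges+missing : ∀ {n} (G : Graph n) s → EdgesWithin G s →
  edges G + missing s G ≡ choose2 (count s)
edges+missing G s within = begin
  edges G + missing s G
    ≡⟨ cong (_+ missing s G) (edges≡pairCount G) ⟩
  pairCount (adj G) + missing s G
    ≡⟨ sym (pairCount-disjoint-∨ (adj G) (λ i j → (s i ∧ s j) ∧ not (adj G i j)) disjoint) ⟩
  pairCount (λ i j → adj G i j ∨ ((s i ∧ s j) ∧ not (adj G i j)))
    ≡⟨ pairCount-cong fill ⟩
  pairCount (λ i j → s i ∧ s j)
    ≡⟨ pairCount-square s ⟩
  choose2 (count s) ∎
  where
  open ≡-Reasoning
  disjoint : ∀ i j → adj G i j ∧ ((s i ∧ s j) ∧ not (adj G i j)) ≡ false
  disjoint i j with adj G i j
  ... | true  = Bool.∧-zeroʳ _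
  ... | false = refl
  fill : ∀ i j → adj G i j ∨ ((s i ∧ s j) ∧ not (adj G i j)) ≡ s i ∧ s j
  fill i j with adj G i j in e
  ... | true  rewrite within i j e | within j i (trans (adj-sym G j i) e) = refl
  ... | false = Bool.∧-identityʳ _

edges≤choose2 : ∀ {n} (G : Graph n) s → EdgesWithin G s → edges G ≤ choose2 (count s)
edges≤choose2 G s within = subst (edges G ≤_) (edges+missing G s within) (m≤m+n _ _)

missing-addEdge : ∀ {n} (G : Graph n) s u v u≢v → EdgesWithin G s → s u ≡ true → s v ≡ true →
  adj G u v ≡ false → missing s G ≡ suc (missing s (addEdge G u v u≢v))
missing-addEdge {n} G s u v u≢v within su sv uv∉G = +-cancelˡ-≡ (edges G) _ _ (begin
  edges G + missing s G           ≡⟨ edges+missing G s within ⟩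
  choose2 (count s)               ≡⟨ sym (edges+missing G′ s (EdgesWithin-addEdge G s u v u≢v within su sv)) ⟩
  edges G′ + missing s G′         ≡⟨ cong (_+ missing s G′) (edges-addEdge G u v u≢v uv∉G) ⟩
  suc (edges G) + missing s G′    ≡⟨ sym (+-suc (edges G) (missing s G′)) ⟩
  edges G + suc (missing s G′)    ∎)
  where
  open ≡-Reasoning
  G′ : Graph n
  G′ = addEdge G u v u≢v

-- Vertex sets given by enumerations

image : ∀ {m n} → (Fin m → Fin n) → Fin n → Bool
image {zero}  c v = false
image {suc m} c v = ⌊ v ≟ c zero ⌋ ∨ image (c ∘ suc) v

image-∋ : ∀ {m n} (c : Fin m → Fin n) i → image c (c i) ≡ true
image-∋ c zero with c zero ≟ c zero
... | yes _  = refl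
... | no c≢c = ⊥-elim (c≢c refl)
image-∋ c (suc i) = trans (cong (⌊ c (suc i) ≟ c zero ⌋ ∨_) (image-∋ (c ∘ suc) i))
                          (Bool.∨-zeroʳ _)

image⁻ : ∀ {m n} (c : Fin m → Fin n) v → image c v ≡ true → ∃ λ i → c i ≡ v
image⁻ {suc m} c v e with v ≟ c zero
... | yes v≡c₀ = zero , sym v≡c₀
... | no _ with image⁻ (c ∘ suc) v e
...   | i , cᵢ≡v = suc i , cᵢ≡v

image-∌ : ∀ {m n} (c : Fin m → Fin n) v → image c v ≡ false → ∀ i → c i ≢ v
image-∌ c v v∉c i refl = false≢true (trans (sym v∉c) (image-∋ c i))

count-image : ∀ {m n} (c : Fin m → Fin n) → Injective _≡_ _≡_ c → count (image c) ≡ m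
count-image {zero} {n} c _ = ∑-zero {n} (λ _ → refl)
count-image {suc m} {n} c c-inj = begin
  count (image c)
    ≡⟨ sum-cong-≗ split ⟩
  ∑[ v < n ] (𝟙 ⌊ v ≟ c zero ⌋ + 𝟙 (image (c ∘ suc) v))
    ≡⟨ ∑-distrib-+ (λ v → 𝟙 ⌊ v ≟ c zero ⌋) (λ v → 𝟙 (image (c ∘ suc) v)) ⟩
  ∑[ v < n ] 𝟙 ⌊ v ≟ c zero ⌋ + count (image (c ∘ suc))
    ≡⟨ cong₂ _+_ (∑-indicator (c zero) 1) (count-image (c ∘ suc) (suc-injectiveᶠ ∘ c-inj)) ⟩
  suc m ∎
  where
  open ≡-Reasoning
  split : ∀ v → 𝟙 (image c v) ≡ 𝟙 ⌊ v ≟ c zero ⌋ + 𝟙 (image (c ∘ suc) v)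
  split v with v ≟ c zero
  ... | no _ = refl
  ... | yes refl with image (c ∘ suc) (c zero) in e
  ...   | false = refl
  ...   | true with image⁻ (c ∘ suc) (c zero) e
  ...     | i , cᵢ≡c₀ with c-inj cᵢ≡c₀
  ...       | ()

image-∷-∌ : ∀ {m n} (w : Fin n) (c : Fin m → Fin n) x → image (w ∷ c) x ≡ false →
  x ≢ w × image c x ≡ false
image-∷-∌ w c x x∉ with x ≟ w
... | yes _   = ⊥-elim (false≢true (sym x∉))
... | no x≢w  = x≢w , x∉

∷-injective : ∀ {m n} {w : Fin n} {c : Fin m → Fin n} → Injective _≡_ _≡_ c → image c w ≡ false →
  Injective _≡_ _≡_ (w ∷ c)
∷-injective c-inj w∉c {zero}  {zero}  _ = refl
∷-injective c-inj w∉c {zero}  {suc j} e = ⊥-elim (image-∌ _ _ w∉c j (sym e))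
∷-injective c-inj w∉c {suc i} {zero}  e = ⊥-elim (image-∌ _ _ w∉c i e)
∷-injective c-inj w∉c {suc i} {suc j} e = cong suc (c-inj e)

-- Matchings along sequences of vertices

HasMatching-mono : ∀ {n} {G H : Graph n} k → G ⊆ H → HasMatching G k → HasMatching H k
HasMatching-mono k G⊆H (a , b , ab∈G , rest) = a , b , (λ i → ⊆-adj G⊆H _ _ (ab∈G i)) , rest

-- Pigeonhole on the 2k distinct matched vertices.
¬HasMatching-within : ∀ {m n} (H : Graph n) k (c : Fin m → Fin n) →
  EdgesWithin H (image c) → m < k + k → ¬ HasMatching H k
¬HasMatching-within {m} {n} H k c within m<2k (a , b , ab∈H , a-inj , b-inj , a≢b) =
  collision (pigeonhole m<2k position)
  where
  ends : Fin (k + k) → Fin n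
  ends t = [ a , b ]′ (splitAt k t)
  ends∈c : ∀ t → image c (ends t) ≡ true
  ends∈c t with splitAt k t
  ... | inj₁ i = within (a i) (b i) (ab∈H i)
  ... | inj₂ i = within (b i) (a i) (trans (adj-sym H (b i) (a i)) (ab∈H i))
  position : Fin (k + k) → Fin m
  position t = proj₁ (image⁻ c (ends t) (ends∈c t))
  position-ends : ∀ t → c (position t) ≡ ends t
  position-ends t = proj₂ (image⁻ c (ends t) (ends∈c t))
  ends-inj : ∀ s t → ends s ≡ ends t → s ≡ t
  ends-inj s t e with splitAt k s in es | splitAt k t in et
  ... | inj₁ i | inj₁ j =
    trans (sym (splitAt⁻¹-↑ˡ es)) (trans (cong (_↑ˡ k) (a-inj i j e)) (splitAt⁻¹-↑ˡ et))
  ... | inj₂ i | inj₂ j =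
    trans (sym (splitAt⁻¹-↑ʳ es)) (trans (cong (k ↑ʳ_) (b-inj i j e)) (splitAt⁻¹-↑ʳ et))
  ... | inj₁ i | inj₂ j = ⊥-elim (a≢b i j e)
  ... | inj₂ i | inj₁ j = ⊥-elim (a≢b j i (sym e))
  collision : (∃ λ s → ∃ λ t → s <ᶠ t × position s ≡ position t) → ⊥
  collision (s , t , s<t , same) = <-irrefl s≡t s<t
    where
    s≡t : toℕ s ≡ toℕ t
    s≡t = cong toℕ (ends-inj s t (trans (sym (position-ends s)) (trans (cong c same) (position-ends t))))

InjectiveBelow : ∀ {A : Set} → ℕ → (ℕ → A) → Set
InjectiveBelow N f = ∀ i j → i < N → j < N → f i ≡ f j → i ≡ j

InjectiveBelow-≤ : ∀ {A : Set} {M N} {f : ℕ → A} → N ≤ M → InjectiveBelow M f → InjectiveBelow N f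
InjectiveBelow-≤ N≤M f-inj i j i<N j<N = f-inj i j (<-≤-trans i<N N≤M) (<-≤-trans j<N N≤M)

Avoids : ∀ {A : Set} → ℕ → (ℕ → A) → A → Set
Avoids N f x = ∀ j → j < N → f j ≢ x

infixr 5 _◂_

_◂_ : ∀ {A : Set} → A → (ℕ → A) → ℕ → A
(x ◂ f) zero    = x
(x ◂ f) (suc j) = f j

insertAt : ∀ {A : Set} → ℕ → A → (ℕ → A) → ℕ → A
insertAt zero    x f = x ◂ f
insertAt (suc J) x f = f zero ◂ insertAt J x (f ∘ suc)

insertAt-< : ∀ {A : Set} J (x : A) f {p} → p < J → insertAt J x f p ≡ f p
insertAt-< (suc J) x f {zero}  _         = refl
insertAt-< (suc J) x f {suc p} (s≤s p<J) = insertAt-< J x (f ∘ suc) p<J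

insertAt-≡ : ∀ {A : Set} J (x : A) f → insertAt J x f J ≡ x
insertAt-≡ zero    x f = refl
insertAt-≡ (suc J) x f = insertAt-≡ J x (f ∘ suc)

insertAt-> : ∀ {A : Set} J (x : A) f {p} → J ≤ p → insertAt J x f (suc p) ≡ f p
insertAt-> zero    x f         _         = refl
insertAt-> (suc J) x f {suc p} (s≤s J≤p) = insertAt-> J x (f ∘ suc) J≤p

◂-injective : ∀ {A : Set} {N} {x : A} {f} → InjectiveBelow N f → Avoids N f x →
  InjectiveBelow (suc N) (x ◂ f)
◂-injective f-inj f∌x zero    zero    _         _         _ = refl
◂-injective f-inj f∌x zero    (suc j) _         (s≤s j<N) e = ⊥-elim (f∌x j j<N (sym e))
◂-injective f-inj f∌x (suc i) zero    (s≤s i<N) _         e = ⊥-elim (f∌x i i<N e)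
◂-injective f-inj f∌x (suc i) (suc j) (s≤s i<N) (s≤s j<N) e = cong suc (f-inj i j i<N j<N e)

insertAt-avoids : ∀ {A : Set} J N {x y : A} {f} → J ≤ N → x ≢ y → Avoids N f y →
  Avoids (suc N) (insertAt J x f) y
insertAt-avoids zero    N       _         x≢y f∌y zero    _         = x≢y
insertAt-avoids zero    N       _         x≢y f∌y (suc j) (s≤s j<N) = f∌y j j<N
insertAt-avoids (suc J) (suc N) _         x≢y f∌y zero    _         = f∌y 0 (s≤s z≤n)
insertAt-avoids (suc J) (suc N) (s≤s J≤N) x≢y f∌y (suc j) (s≤s j<N) =
  insertAt-avoids J N J≤N x≢y (λ i i<N → f∌y (suc i) (s≤s i<N)) j j<N

insertAt-injective : ∀ {A : Set} J N {x : A} {f} → J ≤ N → InjectiveBelow N f → Avoids N f x →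
  InjectiveBelow (suc N) (insertAt J x f)
insertAt-injective zero    N       _         f-inj f∌x = ◂-injective f-inj f∌x
insertAt-injective (suc J) (suc N) {x} {f} (s≤s J≤N) f-inj f∌x =
  ◂-injective (insertAt-injective J N J≤N tail-inj tail∌x) (insertAt-avoids J N J≤N x≢f₀ tail∌f₀)
  where
  tail-inj : InjectiveBelow N (f ∘ suc)
  tail-inj i j i<N j<N e = suc-injective (f-inj (suc i) (suc j) (s≤s i<N) (s≤s j<N) e)
  tail∌x : Avoids N (f ∘ suc) x
  tail∌x j j<N = f∌x (suc j) (s≤s j<N)
  x≢f₀ : x ≢ f zero
  x≢f₀ e = f∌x zero (s≤s z≤n) (sym e)
  tail∌f₀ : Avoids N (f ∘ suc) (f zero)
  tail∌f₀ j j<N e with f-inj (suc j) zero (s≤s j<N) (s≤s z≤n) e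
  ... | ()

m<n⇒1+2m<2n : ∀ {m n} → m < n → suc (2 * m) < 2 * n
m<n⇒1+2m<2n {m} {n} m<n = subst (_≤ 2 * n) (*-suc 2 m) (*-monoʳ-≤ 2 m<n)

[1+r]+[1+r]≡2+2r : ∀ r → suc r + suc r ≡ suc (suc (2 * r))
[1+r]+[1+r]≡2+2r r = cong suc (trans (+-suc r r) (cong (λ x → suc (r + x)) (sym (+-identityʳ r))))

HasMatching-sequence : ∀ {n} (H : Graph n) k (f : ℕ → Fin n) →
  (∀ t → t < k → adj H (f (2 * t)) (f (suc (2 * t))) ≡ true) → InjectiveBelow (2 * k) f →
  HasMatching H k
HasMatching-sequence H k f pairs f-inj =
  (λ t → f (2 * toℕ t)) , (λ t → f (suc (2 * toℕ t))) , (λ t → pairs (toℕ t) (toℕ<n t)) ,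
  (λ s t e → toℕ-injective (*-cancelˡ-≡ (toℕ s) (toℕ t) 2 (f-inj _ _ (even< s) (even< t) e))) ,
  (λ s t e → toℕ-injective (*-cancelˡ-≡ (toℕ s) (toℕ t) 2
                              (suc-injective (f-inj _ _ (odd< s) (odd< t) e)))) ,
  (λ s t e → even≢odd (toℕ s) (toℕ t) (f-inj _ _ (even< s) (odd< t) e))
  where
  odd< : ∀ (t : Fin k) → suc (2 * toℕ t) < 2 * k
  odd< t = m<n⇒1+2m<2n (toℕ<n t)
  even< : ∀ (t : Fin k) → 2 * toℕ t < 2 * k
  even< t = <-trans (n<1+n _) (odd< t)

module CycleMatchings {n} (H : Graph n) (m : ℕ) (cyc : ℕ → Fin n)
  (cyc-adj : ∀ j → adj H (cyc j) (cyc (suc j)) ≡ true)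
  (cyc-inj : ∀ l → InjectiveBelow m (λ i → cyc (l + i))) where

  OffCycle : Fin n → Set
  OffCycle x = ∀ j → cyc j ≢ x

  cycFrom : ℕ → ℕ → Fin n
  cycFrom l i = cyc (l + i)

  cycFrom-adj : ∀ l i → adj H (cycFrom l i) (cycFrom l (suc i)) ≡ true
  cycFrom-adj l i rewrite +-suc l i = cyc-adj (l + i)

  pair-suc : ∀ (f : ℕ → Fin n) t → adj H (f (suc (suc (2 * t)))) (f (suc (suc (suc (2 * t))))) ≡ true →
    adj H (f (2 * suc t)) (f (suc (2 * suc t))) ≡ true
  pair-suc f t = subst (λ p → adj H (f p) (f (suc p)) ≡ true) (sym (*-suc 2 t))

  matching-off-cycle-edge : ∀ r → 2 * r ≤ m → ∀ x y → OffCycle x → OffCycle y → x ≢ y →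
    adj H x y ≡ true → HasMatching H (suc r)
  matching-off-cycle-edge r 2r≤m x y x∉ y∉ x≢y x~y = HasMatching-sequence H (suc r) f pairs f-inj
    where
    f : ℕ → Fin n
    f = x ◂ y ◂ cyc
    pairs : ∀ t → t < suc r → adj H (f (2 * t)) (f (suc (2 * t))) ≡ true
    pairs zero    _ = x~y
    pairs (suc t) _ = pair-suc f t (cyc-adj (2 * t))
    f-inj : InjectiveBelow (2 * suc r) f
    f-inj = subst (λ N → InjectiveBelow N f) (sym (*-suc 2 r))
      (◂-injective (◂-injective (InjectiveBelow-≤ 2r≤m (cyc-inj 0)) (λ j _ → y∉ j))
                   (insertAt-avoids 0 (2 * r) z≤n (x≢y ∘ sym) (λ j _ → x∉ j)))

  matching-odd-cycle-pendant : ∀ r → m ≡ suc (2 * r) → ∀ x l → OffCycle x →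
    adj H x (cyc l) ≡ true → HasMatching H (suc r)
  matching-odd-cycle-pendant r m≡2r+1 x l x∉ x~cₗ = HasMatching-sequence H (suc r) f pairs f-inj
    where
    f : ℕ → Fin n
    f = x ◂ cycFrom l
    pairs : ∀ t → t < suc r → adj H (f (2 * t)) (f (suc (2 * t))) ≡ true
    pairs zero    _ = subst (λ j → adj H x (cyc j) ≡ true) (sym (+-identityʳ l)) x~cₗ
    pairs (suc t) _ = pair-suc f t (cycFrom-adj l (suc (2 * t)))
    f-inj : InjectiveBelow (2 * suc r) f
    f-inj = subst (λ N → InjectiveBelow N f) (trans (cong suc m≡2r+1) (sym (*-suc 2 r)))
      (◂-injective (cyc-inj l) (λ j _ → x∉ (l + j)))

  -- x is matched to cyc l and w to cyc (l + J); as J is odd, the two remaining arcs of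
  -- the cycle have even length and are matched along the cycle.
  matching-even-cycle-pendants : ∀ r → m ≡ 2 * r → ∀ x w → OffCycle x → OffCycle w → x ≢ w →
    ∀ l e → suc (2 * e) < m → adj H x (cyc l) ≡ true → adj H w (cycFrom l (suc (2 * e))) ≡ true →
    HasMatching H (suc r)
  matching-even-cycle-pendants r m≡2r x w x∉ w∉ x≢w l e J<m x~cₗ w~cⱼ =
    HasMatching-sequence H (suc r) f pairs f-inj
    where
    J : ℕ
    J = suc (2 * e)
    g f : ℕ → Fin n
    g = insertAt J w (cycFrom l)
    f = x ◂ g
    middle : ∀ t → adj H (g (suc (2 * t))) (g (suc (suc (2 * t)))) ≡ true
    middle t with <-cmp t e
    ... | tri< t<e _ _ = subst₂ (λ a b → adj H a b ≡ true)
            (sym (insertAt-< J w (cycFrom l) (s≤s (*-monoʳ-< 2 t<e))))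
            (sym (insertAt-< J w (cycFrom l) (s≤s (m<n⇒1+2m<2n t<e))))
            (cycFrom-adj l (suc (2 * t)))
    ... | tri≈ _ refl _ = subst₂ (λ a b → adj H a b ≡ true)
            (sym (insertAt-≡ J w (cycFrom l)))
            (sym (insertAt-> J w (cycFrom l) ≤-refl))
            w~cⱼ
    ... | tri> _ _ e<t = subst₂ (λ a b → adj H a b ≡ true)
            (sym (insertAt-> J w (cycFrom l) (*-monoʳ-< 2 e<t)))
            (sym (insertAt-> J w (cycFrom l) (m≤n⇒m≤1+n (*-monoʳ-< 2 e<t))))
            (cycFrom-adj l (2 * t))
    pairs : ∀ t → t < suc r → adj H (f (2 * t)) (f (suc (2 * t))) ≡ true
    pairs zero    _ = subst (λ j → adj H x (cyc j) ≡ true) (sym (+-identityʳ l)) x~cₗ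
    pairs (suc t) _ = pair-suc f t (middle t)
    f-inj : InjectiveBelow (2 * suc r) f
    f-inj = subst (λ N → InjectiveBelow N f) (trans (cong (λ N → suc (suc N)) m≡2r) (sym (*-suc 2 r)))
      (◂-injective (insertAt-injective J m (<⇒≤ J<m) (cyc-inj l) (λ j _ → w∉ (l + j)))
                   (insertAt-avoids J m (<⇒≤ J<m) (x≢w ∘ sym) (λ j _ → x∉ (l + j))))

-- Enumerated cycles

shift%≡⇒≡0 : ∀ m .{{_ : NonZero m}} x d → x < m → d < m → (x + d) % m ≡ x → d ≡ 0
shift%≡⇒≡0 m x d x<m d<m same with x + d <? m
... | yes x+d<m = +-cancelˡ-≡ x d 0 (trans (trans (sym (m<n⇒m%n≡m x+d<m)) same) (sym (+-identityʳ x)))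
... | no x+d≮m = ⊥-elim (<-irrefl (+-cancelˡ-≡ x d m x+d≡x+m) d<m)
  where
  m≤x+d : m ≤ x + d
  m≤x+d = ≮⇒≥ x+d≮m
  x+d∸m<m : x + d ∸ m < m
  x+d∸m<m = subst (x + d ∸ m <_) (m+n∸m≡n m m) (∸-monoˡ-< (+-mono-< x<m d<m) m≤x+d)
  x+d≡x+m : x + d ≡ x + m
  x+d≡x+m = trans (sym (m∸n+n≡m m≤x+d))
    (cong (_+ m) (trans (sym (m<n⇒m%n≡m x+d∸m<m)) (trans (m≤n⇒[n∸m]%m≡n%m m≤x+d) same)))

%-window-injective : ∀ m .{{_ : NonZero m}} l → InjectiveBelow m (λ i → (l + i) % m)
%-window-injective m l i j i<m j<m same =
  [ (λ i≤j → ordered i j i≤j j<m same) , (λ j≤i → sym (ordered j i j≤i i<m (sym same))) ]′ (≤-total i j)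
  where
  ordered : ∀ i j → i ≤ j → j < m → (l + i) % m ≡ (l + j) % m → i ≡ j
  ordered i j i≤j j<m same = trans (sym (+-identityʳ i)) (trans (cong (i +_) (sym gap≡0)) (m+[n∸m]≡n i≤j))
    where
    open ≡-Reasoning
    gap<m : j ∸ i < m
    gap<m = ≤-<-trans (m∸n≤m j i) j<m
    shifted : ((l + i) % m + (j ∸ i)) % m ≡ (l + i) % m
    shifted = begin
      ((l + i) % m + (j ∸ i)) % m         ≡⟨ cong (λ z → ((l + i) % m + z) % m) (sym (m<n⇒m%n≡m gap<m)) ⟩
      ((l + i) % m + (j ∸ i) % m) % m     ≡⟨ sym (%-distribˡ-+ (l + i) (j ∸ i) m) ⟩
      (l + i + (j ∸ i)) % m               ≡⟨ cong (_% m) (+-assoc l i (j ∸ i)) ⟩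
      (l + (i + (j ∸ i))) % m             ≡⟨ cong (λ z → (l + z) % m) (m+[n∸m]≡n i≤j) ⟩
      (l + j) % m                         ≡⟨ sym same ⟩
      (l + i) % m                         ∎
    gap≡0 : j ∸ i ≡ 0
    gap≡0 = shift%≡⇒≡0 m ((l + i) % m) (j ∸ i) (m%n<n (l + i) m) gap<m shifted

even-or-odd : ∀ d → ∃ λ e → d ≡ 2 * e ⊎ d ≡ suc (2 * e)
even-or-odd zero = 0 , inj₁ refl
even-or-odd (suc d) with even-or-odd d
... | e , inj₁ d≡2e   = e , inj₂ (cong suc d≡2e)
... | e , inj₂ d≡2e+1 = suc e , inj₁ (trans (cong suc d≡2e+1) (sym (*-suc 2 e)))

module CyclicEnumeration {n m} (1<m : 1 < m) (c : Fin m → Fin n) where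

  private instance
    m≢0 : NonZero m
    m≢0 = >-nonZero (<-trans (s≤s z≤n) 1<m)

  cyc : ℕ → Fin n
  cyc j = c (fromℕ< (m%n<n j m))

  cyc-% : ∀ {a b} → a % m ≡ b % m → cyc a ≡ cyc b
  cyc-% a≡b = cong c (toℕ-injective (trans (toℕ-fromℕ< _) (trans a≡b (sym (toℕ-fromℕ< _)))))

  cyc-toℕ : ∀ i → cyc (toℕ i) ≡ c i
  cyc-toℕ i = cong c (toℕ-injective (trans (toℕ-fromℕ< _) (m<n⇒m%n≡m (toℕ<n i))))

  cyc∈image : ∀ j → image c (cyc j) ≡ true
  cyc∈image j = image-∋ c _

  image⇒cyc : ∀ v → image c v ≡ true → ∃ λ j → j < m × cyc j ≡ v
  image⇒cyc v v∈c with image⁻ c v v∈c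
  ... | i , cᵢ≡v = toℕ i , toℕ<n i , trans (cyc-toℕ i) cᵢ≡v

  image∌⇒cyc≢ : ∀ x → image c x ≡ false → ∀ j → cyc j ≢ x
  image∌⇒cyc≢ x x∉c j = image-∌ c x x∉c _

  cyc-window-injective : Injective _≡_ _≡_ c → ∀ l → InjectiveBelow m (λ i → cyc (l + i))
  cyc-window-injective c-inj l i j i<m j<m cᵢ≡cⱼ = %-window-injective m l i j i<m j<m
    (trans (sym (toℕ-fromℕ< _)) (trans (cong toℕ (c-inj cᵢ≡cⱼ)) (toℕ-fromℕ< _)))

  suc-% : ∀ j → suc j % m ≡ suc (j % m) % m
  suc-% j = trans (%-distribˡ-+ 1 j m) (cong (λ z → (z + j % m) % m) (m<n⇒m%n≡m 1<m))

  cyc-adj : ∀ {G : Graph n} → IsCycleEnum G c → ∀ j → adj G (cyc j) (cyc (suc j)) ≡ true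
  cyc-adj (_ , consecutive , closing) j with m≤n⇒m<n∨m≡n (m%n<n j m)
  ... | inj₁ 1+j%m<m = consecutive _ _
          (trans (toℕ-fromℕ< _) (trans (suc-% j) (trans (m<n⇒m%n≡m 1+j%m<m) (cong suc (sym (toℕ-fromℕ< _))))))
  ... | inj₂ 1+j%m≡m = closing _ _
          (trans (toℕ-fromℕ< _) (cong (_∸ 1) 1+j%m≡m))
          (trans (toℕ-fromℕ< _) (trans (suc-% j) (trans (cong (_% m) 1+j%m≡m) (n%n≡0 m))))

  offset : ∀ {i l} → i < m → l < m → ∃ λ d → d < m × cyc (l + d) ≡ cyc i × cyc (l + suc d) ≡ cyc (suc i)
  offset {i} {l} i<m l<m with l ≤? i
  ... | yes l≤i = i ∸ l , ≤-<-trans (m∸n≤m i l) i<m ,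
                  cong cyc (m+[n∸m]≡n l≤i) , cong cyc (trans (+-suc l (i ∸ l)) (cong suc (m+[n∸m]≡n l≤i)))
  ... | no  l≰i = i + m ∸ l , gap<m ,
                  trans (cong cyc l+gap≡i+m) (cyc-% ([m+n]%n≡m%n i m)) ,
                  trans (cong cyc (trans (+-suc l _) (cong suc l+gap≡i+m))) (cyc-% ([m+n]%n≡m%n (suc i) m))
    where
    l≤i+m : l ≤ i + m
    l≤i+m = ≤-trans (<⇒≤ l<m) (m≤n+m m i)
    l+gap≡i+m : l + (i + m ∸ l) ≡ i + m
    l+gap≡i+m = m+[n∸m]≡n l≤i+m
    gap<m : i + m ∸ l < m
    gap<m = subst (i + m ∸ l <_) (m+n∸m≡n l m) (∸-monoˡ-< (+-monoˡ-< m (≰⇒> l≰i)) l≤i+m)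

  odd-offset : ∀ r → m ≡ 2 * r → ∀ {i l} → i < m → l < m → ∃ λ e → suc (2 * e) < m ×
    (cyc (l + suc (2 * e)) ≡ cyc i ⊎ cyc (l + suc (2 * e)) ≡ cyc (suc i))
  odd-offset r m≡2r i<m l<m with offset i<m l<m
  ... | d , d<m , at-i , at-suc-i with even-or-odd d
  ...   | e , inj₂ refl = e , d<m , inj₁ at-i
  ...   | e , inj₁ refl = e , 2e+1<m , inj₂ at-suc-i
    where
    2e+1<m : suc (2 * e) < m
    2e+1<m = subst (suc (2 * e) <_) (sym m≡2r)
               (m<n⇒1+2m<2n (*-cancelˡ-< 2 e r (subst (2 * e <_) m≡2r d<m)))

-- The saturation game

degree≡0⇒adj≡false : ∀ {n} (G : Graph n) u → degree G u ≡ 0 → ∀ v → adj G u v ≡ false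
degree≡0⇒adj≡false G u deg≡0 v with adj G u v in uv
... | false = refl
... | true  = ⊥-elim (1+n≢0 (subst (λ b → 𝟙 b ≡ 0) uv (∑≡0⇒≡0 (λ w → 𝟙 (adj G u w)) ∑≡0 v)))
  where
  ∑≡0 : ∑[ w < _ ] 𝟙 (adj G u w) ≡ 0
  ∑≡0 = trans (sym (sum-map-allFin (λ w → 𝟙 (adj G u w)))) deg≡0

isolated⇒EdgesWithin : ∀ {n m} (G : Graph n) (c : Fin m → Fin n) →
  (∀ u → (∀ i → c i ≢ u) → degree G u ≡ 0) → EdgesWithin G (image c)
isolated⇒EdgesWithin G c isolated x y xy∈G with image c x in x∈c
... | true  = refl
... | false = ⊥-elim (false≢true
                (trans (sym (degree≡0⇒adj≡false G x (isolated x (image-∌ c x x∈c)) y)) xy∈G))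

MissingPair : ∀ {n} → (Fin n → Bool) → Graph n → Set
MissingPair s G = ∃ λ u → ∃ λ v → s u ≡ true × s v ≡ true × u ≢ v × adj G u v ≡ false

missingPair? : ∀ {n} (s : Fin n → Bool) (G : Graph n) → Dec (MissingPair s G)
missingPair? s G = any? λ u → any? λ v →
  (s u Bool.≟ true) ×-dec (s v Bool.≟ true) ×-dec ¬? (u ≟ v) ×-dec (adj G u v Bool.≟ false)

¬MissingPair⇒missing≡0 : ∀ {n} (s : Fin n → Bool) (G : Graph n) → ¬ MissingPair s G → missing s G ≡ 0
¬MissingPair⇒missing≡0 {n} s G none = ∑-zero {n} (λ i → ∑-zero {n} (entry i))
  where
  entry : ∀ i j → 𝟙 ((toℕ i <ᵇ toℕ j) ∧ ((s i ∧ s j) ∧ not (adj G i j))) ≡ 0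
  entry i j with s i in si | s j in sj | adj G i j in ij
  ... | true | true | false with i ≟ j
  ...   | yes refl rewrite n<ᵇn≡false (toℕ i) = refl
  ...   | no i≢j = ⊥-elim (none (i , j , si , sj , i≢j , ij))
  entry i j | true  | true  | true = cong 𝟙 (Bool.∧-zeroʳ _)
  entry i j | true  | false | _    = cong 𝟙 (Bool.∧-zeroʳ _)
  entry i j | false | _     | _    = cong 𝟙 (Bool.∧-zeroʳ _)

-- Play confined to the m < 2k vertices of S: no move inside S is ever illegal, and once
-- every edge leaving S creates a k-matching (Closed), Mini may play any edge of S.
module ConfinedGame {n} (k : ℕ) {m} (d : Fin m → Fin n) (d-inj : Injective _≡_ _≡_ d) (m<2k : m < k + k) where

  S : Fin n → Bool
  S = image d

  Closed : Graph n → Set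
  Closed G = ∀ u v (u≢v : u ≢ v) → S u ≡ false ⊎ S v ≡ false → HasMatching (addEdge G u v u≢v) k

  Confined : Graph n → Set
  Confined G = EdgesWithin G S × Closed G

  legal-inside : ∀ {G u v} → EdgesWithin G S → S u ≡ true → S v ≡ true → (u≢v : u ≢ v) →
    adj G u v ≡ false → Legal k G u v
  legal-inside {G} {u} {v} within su sv u≢v uv∉G = record
    { distinct = u≢v ; nonEdge = uv∉G
    ; noMatch = ¬HasMatching-within (addEdge G u v u≢v) k d (EdgesWithin-addEdge G S u v u≢v within su sv) m<2k }

  legal⇒inside : ∀ {G u v} → Closed G → Legal k G u v → S u ≡ true × S v ≡ true
  legal⇒inside {u = u} {v} closed l with S u in su | S v in sv
  ... | true  | true  = refl , refl
  ... | false | _     = ⊥-elim (noMatch l (closed u v (distinct l) (inj₁ su)))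
  ... | true  | false = ⊥-elim (noMatch l (closed u v (distinct l) (inj₂ sv)))

  Confined-play : ∀ {G u v} → Confined G → (l : Legal k G u v) → Confined (play G l)
  Confined-play {G} {u} {v} (within , closed) l =
    EdgesWithin-addEdge G S u v (distinct l) within
      (proj₁ (legal⇒inside closed l)) (proj₂ (legal⇒inside closed l)) ,
    λ x y x≢y out → HasMatching-mono {G = addEdge G x y x≢y} {addEdge (play G l) x y x≢y} k
                      (addEdge-mono x y x≢y (⊆-addEdge G u v (distinct l)))
                      (closed x y x≢y out)

  missing-play : ∀ {G u v N} → Confined G → (l : Legal k G u v) →
    missing S G ≡ suc N → missing S (play G l) ≡ N
  missing-play {G} {u} {v} (within , closed) l missing≡1+N =
    suc-injective (trans (sym (missing-addEdge G S u v (distinct l) within su sv (nonEdge l))) missing≡1+N)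
    where
    su : S u ≡ true
    su = proj₁ (legal⇒inside closed l)
    sv : S v ≡ true
    sv = proj₂ (legal⇒inside closed l)

  mini-forces : ∀ N p G → missing S G ≡ N → Confined G → MiniForces k (choose2 m) p G
  mini-forces N p G missing≡N conf with missingPair? S G
  mini-forces N p G missing≡N conf | no none = finished
    (λ u v l → none (u , v , proj₁ (legal⇒inside (proj₂ conf) l) , proj₂ (legal⇒inside (proj₂ conf) l) ,
                     distinct l , nonEdge l))
    (subst (λ x → edges G ≤ choose2 x) (count-image d d-inj) (edges≤choose2 G S (proj₁ conf)))
  mini-forces zero p G missing≡0 conf | yes (u , v , su , sv , u≢v , uv∉G) =
    ⊥-elim (0≢1+n (trans (sym missing≡0) (missing-addEdge G S u v u≢v (proj₁ conf) su sv uv∉G)))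
  mini-forces (suc N) Max G missing≡N conf | yes (u , v , su , sv , u≢v , uv∉G) =
    maxMove (u , v , legal-inside (proj₁ conf) su sv u≢v uv∉G)
      (λ _ _ l → mini-forces N Mini (play G l) (missing-play conf l missing≡N) (Confined-play conf l))
  mini-forces (suc N) Mini G missing≡N conf | yes (u , v , su , sv , u≢v , uv∉G) =
    miniMove u v l (mini-forces N Max (play G l) (missing-play conf l missing≡N) (Confined-play conf l))
    where
    l : Legal k G u v
    l = legal-inside (proj₁ conf) su sv u≢v uv∉G

module HamiltonianComponent {n m} (1<m : 1 < m) (G₀ : Graph n) (c : Fin m → Fin n)
  (cycle : IsCycleEnum G₀ c) (isolated : ∀ u → (∀ i → c i ≢ u) → degree G₀ u ≡ 0) where

  open CyclicEnumeration 1<m c public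

  C₁ : Fin n → Bool
  C₁ = image c

  c-inj : Injective _≡_ _≡_ c
  c-inj = proj₁ cycle _ _

  G₀-within : EdgesWithin G₀ C₁
  G₀-within = isolated⇒EdgesWithin G₀ c isolated

  module Above {H : Graph n} (G₀⊆H : G₀ ⊆ H) =
    CycleMatchings H m cyc (λ j → ⊆-adj G₀⊆H _ _ (cyc-adj {G₀} cycle j)) (cyc-window-injective c-inj)

score-odd : ∀ {n} r → 1 ≤ r → (G₀ : Graph n) → HamComponentRestIsolated G₀ (suc (2 * r)) →
  MiniForces (suc r) (choose2 (suc (2 * r))) Max G₀
score-odd r 1≤r G₀ (c , cycle , isolated) = mini-forces _ Max G₀ refl (G₀-within , closed)
  where
  1<m : 1 < suc (2 * r)
  1<m = s≤s (≤-trans 1≤r (m≤m+n r (r + 0)))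
  open HamiltonianComponent 1<m G₀ c cycle isolated
  open ConfinedGame (suc r) c c-inj (subst (suc (2 * r) <_) (sym ([1+r]+[1+r]≡2+2r r)) (n<1+n _))
  leaving-edge : ∀ H → G₀ ⊆ H → ∀ x y → C₁ x ≡ false → x ≢ y → adj H x y ≡ true →
    HasMatching H (suc r)
  leaving-edge H G₀⊆H x y x∉C₁ x≢y x~y with C₁ y in C₁y
  ... | false =
    matching-off-cycle-edge r (n≤1+n _) x y (image∌⇒cyc≢ x x∉C₁) (image∌⇒cyc≢ y C₁y) x≢y x~y
    where open Above {H} G₀⊆H
  ... | true with image⇒cyc y C₁y
  ...   | l , _ , refl = matching-odd-cycle-pendant r refl x l (image∌⇒cyc≢ x x∉C₁) x~y
    where open Above {H} G₀⊆H
  closed : Closed G₀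
  closed u v u≢v (inj₁ u∉C₁) =
    leaving-edge (addEdge G₀ u v u≢v) (⊆-addEdge G₀ u v u≢v) u v u∉C₁ u≢v (addEdge-joins G₀ u v u≢v)
  closed u v u≢v (inj₂ v∉C₁) =
    leaving-edge (addEdge G₀ u v u≢v) (⊆-addEdge G₀ u v u≢v) v u v∉C₁ (u≢v ∘ sym)
                 (addEdge-joins′ G₀ u v u≢v)

module EvenComponentGame {n} (r : ℕ) (1≤r : 1 ≤ r) (G₀ : Graph n) (c : Fin (2 * r) → Fin n)
  (cycle : IsCycleEnum G₀ c) (isolated : ∀ u → (∀ i → c i ≢ u) → degree G₀ u ≡ 0) where

  k : ℕ
  k = suc r

  B : ℕ
  B = choose2 (suc (2 * r))

  1<2r : 1 < 2 * r
  1<2r = *-monoʳ-≤ 2 1≤r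

  open HamiltonianComponent 1<2r G₀ c cycle isolated

  1+2r<k+k : suc (2 * r) < k + k
  1+2r<k+k = subst (suc (2 * r) <_) (sym ([1+r]+[1+r]≡2+2r r)) (n<1+n _)

  module Inner = ConfinedGame k c c-inj (<-trans (n<1+n _) 1+2r<k+k)

  module Outer {w} (w∉C₁ : C₁ w ≡ false) = ConfinedGame k (w ∷ c) (∷-injective c-inj w∉C₁) 1+2r<k+k

  C₁+w : Fin n → Fin n → Bool
  C₁+w w = image (w ∷ c)

  C₁⊆C₁+w : ∀ w x → C₁ x ≡ true → C₁+w w x ≡ true
  C₁⊆C₁+w w x x∈C₁ = trans (cong (⌊ x ≟ w ⌋ ∨_) x∈C₁) (Bool.∨-zeroʳ _)

  w∈C₁+w : ∀ w → C₁+w w w ≡ true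
  w∈C₁+w w = image-∋ (w ∷ c) zero

  off-edge : ∀ H → G₀ ⊆ H → ∀ x y → C₁ x ≡ false → C₁ y ≡ false → x ≢ y → adj H x y ≡ true →
    HasMatching H k
  off-edge H G₀⊆H x y x∉C₁ y∉C₁ =
    matching-off-cycle-edge r ≤-refl x y (image∌⇒cyc≢ x x∉C₁) (image∌⇒cyc≢ y y∉C₁)
    where open Above {H} G₀⊆H

  ¬Legal-off-C₁ : ∀ G → G₀ ⊆ G → ∀ {u v} → Legal k G u v → C₁ u ≡ false → C₁ v ≡ false → ⊥
  ¬Legal-off-C₁ G G₀⊆G {u} {v} l u∉C₁ v∉C₁ = noMatch l (off-edge (addEdge G u v (distinct l))
    (⊆-addEdgeʳ G u v (distinct l) G₀⊆G) u v u∉C₁ v∉C₁ (distinct l) (addEdge-joins G u v (distinct l)))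

  leaving-edge : ∀ H → G₀ ⊆ H → ∀ {w} i → C₁ w ≡ false → i < 2 * r →
    adj H w (cyc i) ≡ true → adj H w (cyc (suc i)) ≡ true →
    ∀ x y → C₁+w w x ≡ false → x ≢ y → adj H x y ≡ true → HasMatching H k
  leaving-edge H G₀⊆H {w} i w∉C₁ i<m w~cᵢ w~cᵢ₊₁ x y x∉ x≢y x~y with image-∷-∌ w c x x∉ | C₁ y in C₁y
  ... | _ , x∉C₁ | false = off-edge H G₀⊆H x y x∉C₁ C₁y x≢y x~y
  ... | x≢w , x∉C₁ | true with image⇒cyc y C₁y
  ...   | l , l<m , refl with odd-offset r refl i<m l<m
  ...     | e , J<m , at = matching-even-cycle-pendants r refl x w
                             (image∌⇒cyc≢ x x∉C₁) (image∌⇒cyc≢ w w∉C₁) x≢w l e J<m x~y (w~cⱼ at)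
    where
    open Above {H} G₀⊆H
    w~cⱼ : cyc (l + suc (2 * e)) ≡ cyc i ⊎ cyc (l + suc (2 * e)) ≡ cyc (suc i) →
      adj H w (cyc (l + suc (2 * e))) ≡ true
    w~cⱼ (inj₁ cⱼ≡cᵢ)   = subst (λ z → adj H w z ≡ true) (sym cⱼ≡cᵢ) w~cᵢ
    w~cⱼ (inj₂ cⱼ≡cᵢ₊₁) = subst (λ z → adj H w z ≡ true) (sym cⱼ≡cᵢ₊₁) w~cᵢ₊₁

  closed-by-pendants : ∀ G {w} (w∉C₁ : C₁ w ≡ false) i → i < 2 * r → G₀ ⊆ G →
    adj G w (cyc i) ≡ true → adj G w (cyc (suc i)) ≡ true → Outer.Closed w∉C₁ G
  closed-by-pendants G {w} w∉C₁ i i<m G₀⊆G w~cᵢ w~cᵢ₊₁ x y x≢y =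
    [ (λ x∉ → leaving x y x∉ x≢y (addEdge-joins G x y x≢y)) ,
      (λ y∉ → leaving y x y∉ (x≢y ∘ sym) (addEdge-joins′ G x y x≢y)) ]′
    where
    G⊆H : G ⊆ addEdge G x y x≢y
    G⊆H = ⊆-addEdge G x y x≢y
    leaving : ∀ a b → C₁+w w a ≡ false → a ≢ b → adj (addEdge G x y x≢y) a b ≡ true →
      HasMatching (addEdge G x y x≢y) k
    leaving = leaving-edge (addEdge G x y x≢y) (⊆-addEdgeʳ G x y x≢y G₀⊆G)
                i w∉C₁ i<m (⊆-adj G⊆H _ _ w~cᵢ) (⊆-adj G⊆H _ _ w~cᵢ₊₁)

  cyc-suc≢cyc : ∀ i → cyc (suc i) ≢ cyc i
  cyc-suc≢cyc i cᵢ₊₁≡cᵢ with cyc-window-injective c-inj i 1 0 1<2r (<-trans (s≤s z≤n) 1<2r)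
                              (trans (cong cyc (trans (+-suc i 0) (cong suc (+-identityʳ i))))
                                     (trans cᵢ₊₁≡cᵢ (cong cyc (sym (+-identityʳ i)))))
  ... | ()

  -- Max joined w ∉ C₁ to cyc i; Mini joins w to cyc (i+1) and the game is confined to C₁ ∪ {w}.
  respond-pendant : ∀ G {u v} (l : Legal k G u v) → G₀ ⊆ G → EdgesWithin G C₁ → ∀ {w} i → C₁ w ≡ false →
    i < 2 * r → (u ≡ w × v ≡ cyc i) ⊎ (u ≡ cyc i × v ≡ w) → MiniForces k B Mini (play G l)
  respond-pendant G {u} {v} l G₀⊆G within {w} i w∉C₁ i<m ends =
    miniMove w (cyc (suc i)) reply (Outer.mini-forces w∉C₁ _ Max G₂ refl (within₂ , closed₂))
    where
    G₁ : Graph n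
    G₁ = play G l
    w-isolated : ∀ y → adj G w y ≡ false
    w-isolated y with adj G w y in wy
    ... | false = refl
    ... | true  = ⊥-elim (false≢true (trans (sym w∉C₁) (within w y wy)))
    pendant : adj G₁ w (cyc i) ≡ true × (∀ y → adj G₁ w y ≡ true → y ≡ cyc i)
    pendant = addEdge-pendant G u v (distinct l) w-isolated ends
    w≢cᵢ₊₁ : w ≢ cyc (suc i)
    w≢cᵢ₊₁ w≡cᵢ₊₁ = image∌⇒cyc≢ w w∉C₁ (suc i) (sym w≡cᵢ₊₁)
    fresh : adj G₁ w (cyc (suc i)) ≡ false
    fresh with adj G₁ w (cyc (suc i)) in wcᵢ₊₁
    ... | false = refl
    ... | true  = ⊥-elim (cyc-suc≢cyc i (proj₂ pendant _ wcᵢ₊₁))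
    ends∈ : C₁+w w u ≡ true × C₁+w w v ≡ true
    ends∈ = ends-in {s = C₁+w w} ends (w∈C₁+w w) (C₁⊆C₁+w w _ (cyc∈image i))
    within₁ : EdgesWithin G₁ (C₁+w w)
    within₁ = EdgesWithin-addEdge G _ u v (distinct l) (EdgesWithin-mono {G = G} (C₁⊆C₁+w w) within)
                (proj₁ ends∈) (proj₂ ends∈)
    reply : Legal k G₁ w (cyc (suc i))
    reply = Outer.legal-inside w∉C₁ within₁ (w∈C₁+w w) (C₁⊆C₁+w w _ (cyc∈image (suc i))) w≢cᵢ₊₁ fresh
    G₂ : Graph n
    G₂ = play G₁ reply
    within₂ : EdgesWithin G₂ (C₁+w w)
    within₂ = EdgesWithin-addEdge G₁ _ w (cyc (suc i)) w≢cᵢ₊₁ within₁ (w∈C₁+w w) (C₁⊆C₁+w w _ (cyc∈image (suc i)))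
    G₀⊆G₂ : G₀ ⊆ G₂
    G₀⊆G₂ = ⊆-addEdgeʳ G₁ w (cyc (suc i)) w≢cᵢ₊₁ (⊆-addEdgeʳ G u v (distinct l) G₀⊆G)
    w~cᵢ : adj G₂ w (cyc i) ≡ true
    w~cᵢ = ⊆-adj (⊆-addEdge G₁ w (cyc (suc i)) w≢cᵢ₊₁) _ _ (proj₁ pendant)
    closed₂ : Outer.Closed w∉C₁ G₂
    closed₂ = closed-by-pendants G₂ w∉C₁ i i<m G₀⊆G₂ w~cᵢ (addEdge-joins G₁ w (cyc (suc i)) w≢cᵢ₊₁)

  TouchingMove : Graph n → Set
  TouchingMove G = ∃ λ u → ∃ λ v → u ≢ v × adj G u v ≡ false × (C₁ u ≡ true ⊎ C₁ v ≡ true)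

  touchingMove? : ∀ G → Dec (TouchingMove G)
  touchingMove? G = any? λ u → any? λ v →
    ¬? (u ≟ v) ×-dec (adj G u v Bool.≟ false) ×-dec ((C₁ u Bool.≟ true) ⊎-dec (C₁ v Bool.≟ true))

  legal-touching : ∀ G → EdgesWithin G C₁ → ∀ {u v} → (u≢v : u ≢ v) → adj G u v ≡ false →
    C₁ u ≡ true ⊎ C₁ v ≡ true → Legal k G u v
  legal-touching G within {u} {v} u≢v uv∉G touches with C₁ u in u∈C₁ | C₁ v in v∈C₁
  ... | true  | true  = Inner.legal-inside within u∈C₁ v∈C₁ u≢v uv∉G
  ... | true  | false = Outer.legal-inside v∈C₁ (EdgesWithin-mono {G = G} (C₁⊆C₁+w v) within)
                          (C₁⊆C₁+w v u u∈C₁) (w∈C₁+w v) u≢v uv∉G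
  ... | false | true  = Outer.legal-inside u∈C₁ (EdgesWithin-mono {G = G} (C₁⊆C₁+w u) within)
                          (w∈C₁+w u) (C₁⊆C₁+w u v v∈C₁) u≢v uv∉G
  ... | false | false = ⊥-elim ([ false≢true , false≢true ]′ touches)

  no-touching-move⇒stuck : ∀ G → G₀ ⊆ G → ¬ TouchingMove G → ∀ u v → ¬ Legal k G u v
  no-touching-move⇒stuck G G₀⊆G none u v l with C₁ u in u∈C₁ | C₁ v in v∈C₁
  ... | true  | _     = none (u , v , distinct l , nonEdge l , inj₁ u∈C₁)
  ... | false | true  = none (u , v , distinct l , nonEdge l , inj₂ v∈C₁)
  ... | false | false = ¬Legal-off-C₁ G G₀⊆G l u∈C₁ v∈C₁

  edges≤B : ∀ G → EdgesWithin G C₁ → edges G ≤ B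
  edges≤B G within =
    ≤-trans (subst (λ x → edges G ≤ choose2 x) (count-image c c-inj) (edges≤choose2 G C₁ within))
            (m≤n+m (choose2 (2 * r)) (2 * r))

  -- Parity strategy: Max moves while an even number N + N of pairs inside C₁ are missing,
  -- so Mini can answer every move inside C₁ by another one.
  phase : ∀ N G → missing C₁ G ≡ N + N → G₀ ⊆ G → EdgesWithin G C₁ → MiniForces k B Max G
  respond : ∀ N G → missing C₁ G ≡ N + N → G₀ ⊆ G → EdgesWithin G C₁ →
    ∀ u v (l : Legal k G u v) → MiniForces k B Mini (play G l)
  respond-inside : ∀ N G → missing C₁ G ≡ N + N → G₀ ⊆ G → EdgesWithin G C₁ →
    ∀ {u v} (l : Legal k G u v) → C₁ u ≡ true → C₁ v ≡ true → MiniForces k B Mini (play G l)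

  phase N G even G₀⊆G within with touchingMove? G
  ... | no none = finished (no-touching-move⇒stuck G G₀⊆G none) (edges≤B G within)
  ... | yes (u , v , u≢v , uv∉G , touches) =
    maxMove (u , v , legal-touching G within u≢v uv∉G touches) (respond N G even G₀⊆G within)

  respond N G even G₀⊆G within u v l with C₁ u in u∈C₁ | C₁ v in v∈C₁
  ... | true  | true  = respond-inside N G even G₀⊆G within l u∈C₁ v∈C₁
  ... | false | false = ⊥-elim (¬Legal-off-C₁ G G₀⊆G l u∈C₁ v∈C₁)
  ... | false | true with image⇒cyc v v∈C₁
  ...   | i , i<m , refl = respond-pendant G l G₀⊆G within i u∈C₁ i<m (inj₁ (refl , refl))
  respond N G even G₀⊆G within u v l | true | false with image⇒cyc u u∈C₁
  ...   | i , i<m , refl = respond-pendant G l G₀⊆G within i v∈C₁ i<m (inj₂ (refl , refl))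

  respond-inside zero G even G₀⊆G within l u∈C₁ v∈C₁ =
    ⊥-elim (0≢1+n (trans (sym even) (missing-addEdge G C₁ _ _ (distinct l) within u∈C₁ v∈C₁ (nonEdge l))))
  respond-inside (suc N) G even G₀⊆G within {u} {v} l u∈C₁ v∈C₁ with missingPair? C₁ (play G l)
  ... | no none = ⊥-elim (0≢1+n (trans (sym (¬MissingPair⇒missing≡0 C₁ (play G l) none)) odd))
    where
    odd : missing C₁ (play G l) ≡ suc (N + N)
    odd = suc-injective (trans (sym (missing-addEdge G C₁ u v (distinct l) within u∈C₁ v∈C₁ (nonEdge l)))
                               (trans even (cong suc (+-suc N N))))
  ... | yes (a , b , a∈C₁ , b∈C₁ , a≢b , ab∉G₁) = miniMove a b reply (phase N G₂ even₂ G₀⊆G₂ within₂)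
    where
    G₁ : Graph n
    G₁ = play G l
    within₁ : EdgesWithin G₁ C₁
    within₁ = EdgesWithin-addEdge G C₁ u v (distinct l) within u∈C₁ v∈C₁
    reply : Legal k G₁ a b
    reply = Inner.legal-inside within₁ a∈C₁ b∈C₁ a≢b ab∉G₁
    G₂ : Graph n
    G₂ = play G₁ reply
    within₂ : EdgesWithin G₂ C₁
    within₂ = EdgesWithin-addEdge G₁ C₁ a b a≢b within₁ a∈C₁ b∈C₁
    G₀⊆G₂ : G₀ ⊆ G₂
    G₀⊆G₂ = ⊆-addEdgeʳ G₁ a b a≢b (⊆-addEdgeʳ G u v (distinct l) G₀⊆G)
    even₂ : missing C₁ G₂ ≡ N + N
    even₂ = suc-injective (suc-injective (begin
      suc (suc (missing C₁ G₂)) ≡⟨ cong suc (missing-addEdge G₁ C₁ a b a≢b within₁ a∈C₁ b∈C₁ ab∉G₁) ⟨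
      suc (missing C₁ G₁)       ≡⟨ missing-addEdge G C₁ u v (distinct l) within u∈C₁ v∈C₁ (nonEdge l) ⟨
      missing C₁ G              ≡⟨ even ⟩
      suc (N + suc N)          ≡⟨ cong suc (+-suc N N) ⟩
      suc (suc (N + N))        ∎))
      where open ≡-Reasoning

  score : 2 ∣ (choose2 (2 * r) ∸ edges G₀) → MiniForces k B Max G₀
  score (divides q eq) = phase q G₀ even ⊆-refl G₀-within
    where
    even : missing C₁ G₀ ≡ q + q
    even = begin
      missing C₁ G₀                          ≡⟨ m+n∸m≡n (edges G₀) (missing C₁ G₀) ⟨
      edges G₀ + missing C₁ G₀ ∸ edges G₀    ≡⟨ cong (_∸ edges G₀) (edges+missing G₀ C₁ G₀-within) ⟩
      choose2 (count C₁) ∸ edges G₀          ≡⟨ cong (λ x → choose2 x ∸ edges G₀) (count-image c c-inj) ⟩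
      choose2 (2 * r) ∸ edges G₀            ≡⟨ eq ⟩
      q * 2                                 ≡⟨ *-comm q 2 ⟩
      q + (q + 0)                           ≡⟨ cong (q +_) (+-identityʳ q) ⟩
      q + q                                 ∎
      where open ≡-Reasoning

score-even : ∀ {n} r → 1 ≤ r → (G₀ : Graph n) → HamComponentRestIsolated G₀ (2 * r) →
  2 ∣ (choose2 (2 * r) ∸ edges G₀) → MiniForces (suc r) (choose2 (suc (2 * r))) Max G₀
score-even r 1≤r G₀ (c , cycle , isolated) = EvenComponentGame.score r 1≤r G₀ c cycle isolated

lemma4p7 : (k n : ℕ) → 3 ≤ k → 6 ≤ n → (G₀ : Graph n) → ¬ HasMatching G₀ k →
    (HamComponentRestIsolated G₀ (2 * k ∸ 1) →
       ScoreMiniSecond≤ G₀ k ((2 * k ∸ 1) C 2)) ×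
    (HamComponentRestIsolated G₀ (2 * k ∸ 2) → 2 ∣ ((2 * k ∸ 2) C 2 ∸ edges G₀) →
       ScoreMiniSecond≤ G₀ k ((2 * k ∸ 1) C 2))
lemma4p7 (suc r) n (s≤s 2≤r) _ G₀ _ = part-a , part-b
  where
  1≤r : 1 ≤ r
  1≤r = ≤-trans (s≤s z≤n) 2≤r
  2k∸1≡1+2r : 2 * suc r ∸ 1 ≡ suc (2 * r)
  2k∸1≡1+2r = cong (_∸ 1) (*-suc 2 r)
  2k∸2≡2r : 2 * suc r ∸ 2 ≡ 2 * r
  2k∸2≡2r = cong (_∸ 2) (*-suc 2 r)
  bound : choose2 (suc (2 * r)) ≡ (2 * suc r ∸ 1) C 2
  bound = trans (choose2≡C2 (suc (2 * r))) (cong (_C 2) (sym 2k∸1≡1+2r))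
  part-a : HamComponentRestIsolated G₀ (2 * suc r ∸ 1) → ScoreMiniSecond≤ G₀ (suc r) ((2 * suc r ∸ 1) C 2)
  part-a ham = subst (λ b → MiniForces (suc r) b Max G₀) bound
    (score-odd r 1≤r G₀ (subst (HamComponentRestIsolated G₀) 2k∸1≡1+2r ham))
  part-b : HamComponentRestIsolated G₀ (2 * suc r ∸ 2) → 2 ∣ ((2 * suc r ∸ 2) C 2 ∸ edges G₀) →
    ScoreMiniSecond≤ G₀ (suc r) ((2 * suc r ∸ 1) C 2)
  part-b ham even = subst (λ b → MiniForces (suc r) b Max G₀) bound
    (score-even r 1≤r G₀ (subst (HamComponentRestIsolated G₀) 2k∸2≡2r ham)
      (subst (λ x → 2 ∣ (x ∸ edges G₀)) (trans (cong (_C 2) 2k∸2≡2r) (sym (choose2≡C2 (2 * r)))) even))
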